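{- Let $k\ge 1$. If $m$ is a positive integer with \[ m\equiv \sum_{i=0}^{k}4^i \pmod{4^{k+2}}, \] then $m\equiv 5\pmod 8$, and either $m=\sum_{i=0}^k4^i$ and $S(m)=S^2(m)=1$, or the triple $(m,S(m),S^2(m))$ has permutation pattern $(3,2,1)$, i.e. $S^2(m)<S(m)<m$.
   Context: The Syracuse function $S$ on odd positive integers is defined by $S(m)=(3m+1)/2^e$, where $e$ is the largest integer with $2^e\mid 3m+1$. For a triple $(x_1,x_2,x_3)$ of distinct reals with coordinates in increasing order $y_1<y_2<y_3$, its permutation pattern is the permutation $\sigma$ of $\{1,2,3\}$ with $x_i=y_{\sigma(i)}$, written $(\sigma(1),\sigma(2),\sigma(3))$. -}

module Defs where

open import Data.Nat using (ℕ; zero; suc; _+_; _*_; _^_; _%_; _/_)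
open import Data.Bool using (Bool; true; false; if_then_else_)
open import Data.Nat using (_≡ᵇ_)

-- With fuel n this is the full
-- odd part of n for n ≥ 1 (n has fewer than n factors of 2).
oddPartFuel : ℕ → ℕ → ℕ
oddPartFuel zero    n = n
oddPartFuel (suc f) zero = zero
oddPartFuel (suc f) (suc n) =
  if (suc n % 2) ≡ᵇ 0 then oddPartFuel f (suc n / 2) else suc n

oddPart : ℕ → ℕ
oddPart n = oddPartFuel n n

S : ℕ → ℕ
S m = oddPart (3 * m + 1)

sum4 : ℕ → ℕ
sum4 zero    = 1
sum4 (suc k) = sum4 k + 4 ^ suc k

-- Write A = Σ_{i≤k} 4^i, so that 3A + 1 = 4^(k+1), and m = A + q·4^(k+2).
-- Then 3m + 1 = 4^(k+1)·(1 + 12q) with 1 + 12q odd, so S(m) = 1 + 12q, and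
-- 3S(m) + 1 = 4(1 + 9q) gives S²(m) ≤ 1 + 9q.  For q = 0 this is the orbit
-- A ↦ 1 ↦ 1; for q ≥ 1 we get 1 + 9q < 1 + 12q < m.  Finally A ≡ 5 (mod 8)
-- for k ≥ 1 and 8 ∣ 4^(k+2).
module Submission where

open import Defs
open import Data.Nat using (ℕ; suc; _+_; _*_; _^_; _%_; _<_; _≤_)
open import Data.Sum using (_⊎_)
open import Data.Product using (_×_; ∃-syntax)
open import Relation.Binary.PropositionalEquality using (_≡_)

open import Data.Bool using (true; false)
open import Data.Nat using (zero; _∸_; _/_; _≡ᵇ_; z≤n; s≤s; z<s; >-nonZero)
open import Data.Nat.Properties
open import Data.Nat.DivMod using ([m+kn]%n≡m%n; m*n%n≡0; m*n/n≡m; m/n≤m)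
open import Data.Nat.Tactic.RingSolver using (solve-∀)
open import Data.Sum using (inj₁; inj₂)
open import Data.Product using (_,_)
open import Relation.Binary.PropositionalEquality
  using (refl; sym; trans; cong; subst; module ≡-Reasoning)

n<2^n : ∀ n → n < 2 ^ n
n<2^n zero    = z<s
n<2^n (suc n) = ≤-<-trans (n<2^n n)
  (subst (2 ^ n <_) (*-comm (2 ^ n) 2) (m<m*n (2 ^ n) 2 {{m^n≢0 2 n}} (s≤s (s≤s z≤n))))

oddPartFuel-zero : ∀ f → oddPartFuel f 0 ≡ 0
oddPartFuel-zero zero    = refl
oddPartFuel-zero (suc f) = refl

oddPartFuel-even : ∀ f x → x % 2 ≡ 0 → oddPartFuel (suc f) x ≡ oddPartFuel f (x / 2)
oddPartFuel-even f zero    _      = sym (oddPartFuel-zero f)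
oddPartFuel-even f (suc x) x-even rewrite x-even = refl

oddPartFuel-odd : ∀ f x → x % 2 ≡ 1 → oddPartFuel f x ≡ x
oddPartFuel-odd zero    x       _     = refl
oddPartFuel-odd (suc f) (suc x) x-odd rewrite x-odd = refl

oddPartFuel-≤ : ∀ f x → oddPartFuel f x ≤ x
oddPartFuel-≤ zero    x       = ≤-refl
oddPartFuel-≤ (suc f) zero    = ≤-refl
oddPartFuel-≤ (suc f) (suc x) with suc x % 2 ≡ᵇ 0
... | true  = ≤-trans (oddPartFuel-≤ f (suc x / 2)) (m/n≤m (suc x) 2)
... | false = ≤-refl

oddPartFuel-2* : ∀ f n → oddPartFuel (suc f) (2 * n) ≡ oddPartFuel f n
oddPartFuel-2* f n rewrite *-comm 2 n =
  trans (oddPartFuel-even f (n * 2) (m*n%n≡0 n 2)) (cong (oddPartFuel f) (m*n/n≡m n 2))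

oddPartFuel-2^* : ∀ j f n → oddPartFuel (j + f) (2 ^ j * n) ≡ oddPartFuel f n
oddPartFuel-2^* zero    f n = cong (oddPartFuel f) (*-identityˡ n)
oddPartFuel-2^* (suc j) f n rewrite *-assoc 2 (2 ^ j) n =
  trans (oddPartFuel-2* (j + f) (2 ^ j * n)) (oddPartFuel-2^* j f n)

-- The fuel 2^j·n of oddPart suffices for the j halvings because j < 2^j.
oddPart-2^* : ∀ j n → 1 ≤ n → oddPart (2 ^ j * n) ≡ oddPartFuel (2 ^ j * n ∸ j) n
oddPart-2^* j n 1≤n = begin
  oddPartFuel (2 ^ j * n) (2 ^ j * n)             ≡⟨ cong (λ f → oddPartFuel f (2 ^ j * n)) (sym (m+[n∸m]≡n j≤2^j*n)) ⟩
  oddPartFuel (j + (2 ^ j * n ∸ j)) (2 ^ j * n)   ≡⟨ oddPartFuel-2^* j (2 ^ j * n ∸ j) n ⟩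
  oddPartFuel (2 ^ j * n ∸ j) n                   ∎
  where
  open ≡-Reasoning
  j≤2^j*n : j ≤ 2 ^ j * n
  j≤2^j*n = ≤-trans (<⇒≤ (n<2^n j)) (m≤m*n (2 ^ j) n {{>-nonZero 1≤n}})

oddPart-2^*odd : ∀ j n → n % 2 ≡ 1 → oddPart (2 ^ j * n) ≡ n
oddPart-2^*odd j (suc n) n-odd =
  trans (oddPart-2^* j (suc n) (s≤s z≤n)) (oddPartFuel-odd (2 ^ j * suc n ∸ j) (suc n) n-odd)

oddPart-2^*-≤ : ∀ j n → 1 ≤ n → oddPart (2 ^ j * n) ≤ n
oddPart-2^*-≤ j n 1≤n = subst (_≤ n) (sym (oddPart-2^* j n 1≤n)) (oddPartFuel-≤ (2 ^ j * n ∸ j) n)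

4^[k+2]≡4*4^[1+k] : ∀ k → 4 ^ (k + 2) ≡ 4 * 4 ^ suc k
4^[k+2]≡4*4^[1+k] k = cong (4 ^_) (+-comm k 2)

3*sum4+1≡4^[1+k] : ∀ k → 3 * sum4 k + 1 ≡ 4 ^ suc k
3*sum4+1≡4^[1+k] zero    = refl
3*sum4+1≡4^[1+k] (suc k) = begin
  3 * (sum4 k + 4 ^ suc k) + 1      ≡⟨ distrib (sum4 k) (4 ^ suc k) ⟩
  (3 * sum4 k + 1) + 3 * 4 ^ suc k  ≡⟨ cong (_+ 3 * 4 ^ suc k) (3*sum4+1≡4^[1+k] k) ⟩
  4 ^ suc k + 3 * 4 ^ suc k         ≡⟨ collect (4 ^ suc k) ⟩
  4 * 4 ^ suc k                     ∎
  where
  open ≡-Reasoning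
  distrib : ∀ a p → 3 * (a + p) + 1 ≡ (3 * a + 1) + 3 * p
  distrib = solve-∀
  collect : ∀ p → p + 3 * p ≡ 4 * p
  collect = solve-∀

4^[2+k]≡2*4^k*8 : ∀ k → 4 ^ (2 + k) ≡ 2 * 4 ^ k * 8
4^[2+k]≡2*4^k*8 k = regroup (4 ^ k)
  where
  regroup : ∀ p → 4 * (4 * p) ≡ 2 * p * 8
  regroup = solve-∀

sum4%8≡5 : ∀ k → 1 ≤ k → sum4 k % 8 ≡ 5
sum4%8≡5 (suc zero)    _ = refl
sum4%8≡5 (suc (suc k)) _ = begin
  (sum4 (suc k) + 4 ^ (2 + k)) % 8       ≡⟨ cong (λ t → (sum4 (suc k) + t) % 8) (4^[2+k]≡2*4^k*8 k) ⟩
  (sum4 (suc k) + 2 * 4 ^ k * 8) % 8     ≡⟨ [m+kn]%n≡m%n (sum4 (suc k)) (2 * 4 ^ k) 8 ⟩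
  sum4 (suc k) % 8                       ≡⟨ sum4%8≡5 (suc k) (s≤s z≤n) ⟩
  5                                      ∎
  where open ≡-Reasoning

sum4+q*4^[k+2]%8≡5 : ∀ k q → 1 ≤ k → (sum4 k + q * 4 ^ (k + 2)) % 8 ≡ 5
sum4+q*4^[k+2]%8≡5 k q 1≤k = begin
  (sum4 k + q * 4 ^ (k + 2)) % 8         ≡⟨ cong (λ t → (sum4 k + q * t) % 8) (trans (4^[k+2]≡4*4^[1+k] k) (4^[2+k]≡2*4^k*8 k)) ⟩
  (sum4 k + q * (2 * 4 ^ k * 8)) % 8     ≡⟨ cong (λ t → (sum4 k + t) % 8) (sym (*-assoc q (2 * 4 ^ k) 8)) ⟩
  (sum4 k + q * (2 * 4 ^ k) * 8) % 8     ≡⟨ [m+kn]%n≡m%n (sum4 k) (q * (2 * 4 ^ k)) 8 ⟩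
  sum4 k % 8                             ≡⟨ sum4%8≡5 k 1≤k ⟩
  5                                      ∎
  where open ≡-Reasoning

1≤sum4 : ∀ k → 1 ≤ sum4 k
1≤sum4 zero    = s≤s z≤n
1≤sum4 (suc k) = ≤-trans (1≤sum4 k) (m≤m+n (sum4 k) (4 ^ suc k))

[1+12*q]%2≡1 : ∀ q → (1 + 12 * q) % 2 ≡ 1
[1+12*q]%2≡1 q = trans (cong (λ t → (1 + t) % 2) (regroup q)) ([m+kn]%n≡m%n 1 (6 * q) 2)
  where
  regroup : ∀ q → 12 * q ≡ 6 * q * 2
  regroup = solve-∀

3*[sum4+q*4^[k+2]]+1 : ∀ k q → 3 * (sum4 k + q * 4 ^ (k + 2)) + 1 ≡ 4 ^ suc k * (1 + 12 * q)
3*[sum4+q*4^[k+2]]+1 k q = begin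
  3 * (sum4 k + q * 4 ^ (k + 2)) + 1        ≡⟨ cong (λ t → 3 * (sum4 k + q * t) + 1) (4^[k+2]≡4*4^[1+k] k) ⟩
  3 * (sum4 k + q * (4 * 4 ^ suc k)) + 1    ≡⟨ regroup (sum4 k) q (4 ^ suc k) ⟩
  (3 * sum4 k + 1) + 4 ^ suc k * (12 * q)   ≡⟨ cong (_+ 4 ^ suc k * (12 * q)) (3*sum4+1≡4^[1+k] k) ⟩
  4 ^ suc k + 4 ^ suc k * (12 * q)          ≡⟨ factor (4 ^ suc k) q ⟩
  4 ^ suc k * (1 + 12 * q)                  ∎
  where
  open ≡-Reasoning
  regroup : ∀ a q p → 3 * (a + q * (4 * p)) + 1 ≡ (3 * a + 1) + p * (12 * q)
  regroup = solve-∀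
  factor : ∀ p q → p + p * (12 * q) ≡ p * (1 + 12 * q)
  factor = solve-∀

S[sum4+q*4^[k+2]]≡1+12*q : ∀ k q → S (sum4 k + q * 4 ^ (k + 2)) ≡ 1 + 12 * q
S[sum4+q*4^[k+2]]≡1+12*q k q = begin
  oddPart (3 * (sum4 k + q * 4 ^ (k + 2)) + 1)   ≡⟨ cong oddPart (3*[sum4+q*4^[k+2]]+1 k q) ⟩
  oddPart (4 ^ suc k * (1 + 12 * q))             ≡⟨ cong (λ t → oddPart (t * (1 + 12 * q))) (^-*-assoc 2 2 (suc k)) ⟩
  oddPart (2 ^ (2 * suc k) * (1 + 12 * q))       ≡⟨ oddPart-2^*odd (2 * suc k) (1 + 12 * q) ([1+12*q]%2≡1 q) ⟩
  1 + 12 * q                                     ∎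
  where open ≡-Reasoning

S[1+12*q]≤1+9*q : ∀ q → S (1 + 12 * q) ≤ 1 + 9 * q
S[1+12*q]≤1+9*q q = subst (λ t → oddPart t ≤ 1 + 9 * q) (sym (factor q)) (oddPart-2^*-≤ 2 (1 + 9 * q) (s≤s z≤n))
  where
  factor : ∀ q → 3 * (1 + 12 * q) + 1 ≡ 2 ^ 2 * (1 + 9 * q)
  factor = solve-∀

1+12*q<sum4+q*4^[k+2] : ∀ k q → 1 ≤ q → 1 + 12 * q < sum4 k + q * 4 ^ (k + 2)
1+12*q<sum4+q*4^[k+2] k q 1≤q = +-mono-≤-< (1≤sum4 k)
  (subst (_< q * 4 ^ (k + 2)) (*-comm q 12) (*-monoʳ-< q {{>-nonZero 1≤q}} 12<4^[k+2]))
  where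
  12<4^[k+2] : 12 < 4 ^ (k + 2)
  12<4^[k+2] = <-≤-trans (m<n+m 12 {4} z<s) (^-monoʳ-≤ 4 (m≤n+m 2 k))

sum4-class-orbit : ∀ k q → let m = sum4 k + q * 4 ^ (k + 2) in
  (m ≡ sum4 k × S m ≡ 1 × S (S m) ≡ 1) ⊎ (S (S m) < S m × S m < m)
sum4-class-orbit k zero = inj₁ (+-identityʳ (sum4 k) , Sm≡1 , cong S Sm≡1)
  where
  Sm≡1 : S (sum4 k + 0) ≡ 1
  Sm≡1 = S[sum4+q*4^[k+2]]≡1+12*q k 0
sum4-class-orbit k (suc q) = inj₂ (subst (λ s → S s < s × s < m) (sym Sm≡1+12q)
  (S[1+12q]<1+12q , 1+12*q<sum4+q*4^[k+2] k (suc q) (s≤s z≤n)))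
  where
  m : ℕ
  m = sum4 k + suc q * 4 ^ (k + 2)
  Sm≡1+12q : S m ≡ 1 + 12 * suc q
  Sm≡1+12q = S[sum4+q*4^[k+2]]≡1+12*q k (suc q)
  S[1+12q]<1+12q : S (1 + 12 * suc q) < 1 + 12 * suc q
  S[1+12q]<1+12q = ≤-<-trans (S[1+12*q]≤1+9*q (suc q)) (+-monoʳ-< 1 (*-monoˡ-< (suc q) (m<n+m 9 {3} z<s)))

mainTheorem6 : (k m : ℕ) → 1 ≤ k → 1 ≤ m →
    ∃[ q ] m ≡ sum4 k + q * 4 ^ (k + 2) →
    (m % 8 ≡ 5) ×
    ((m ≡ sum4 k × S m ≡ 1 × S (S m) ≡ 1) ⊎ (S (S m) < S m × S m < m))
mainTheorem6 k m 1≤k _ (q , refl) = sum4+q*4^[k+2]%8≡5 k q 1≤k , sum4-class-orbit k q
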